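{- Let $k\ge3$ be odd, $n\ge2$, and let $f\colon\mathbf C_k^n\to\mathbf C_3$ be a polymorphism. Then $f_{\mathsf E}(O^n_{k,\{1,2\}})=2^{n-2}k^{n-1}(\deg_1f+\deg_2f)\cdot O_3$; that is, $\deg_{1,2}f=\deg_1f+\deg_2f$.
   Context: $\mathbf C_m$ is the $m$-cycle on $\{0,\dots,m-1\}$, vertices adjacent iff they differ by $1$ mod $m$. $\mathbf C_k^n$ is the direct power (vertex set $V(C_k)^n$, $(\bar u,\bar v)$ an edge iff $(u_j,v_j)\in E(C_k)$ for all $j$); a polymorphism is a graph homomorphism $\mathbf C_k^n\to\mathbf C_3$. $\Delta_{\mathsf E}(\mathbf G)$ is the free Abelian group generated by oriented edges $[u,v]$ of $\mathbf G$ with $[u,v]=-[v,u]$; sets of oriented edges are identified with their sums; a homomorphism $f$ induces $f_{\mathsf E}(\sum c_i[u_i,v_i])=\sum c_i[f(u_i),f(v_i)]$. $O_m=[0,1]+\dots+[m-1,0]\in\Delta_{\mathsf E}(\mathbf C_m)$. $O^n_{k,i}$ is the set of oriented edges $[(a_1,\dots,a_n),(b_1,\dots,b_n)]$ of $\mathbf C_k^n$ with $[a_i,b_i]\in O_k$, and $O^n_{k,\{1,2\}}=O^n_{k,1}\cap O^n_{k,2}$. $\deg_if$ is the (existing, unique) integer with $f_{\mathsf E}(O^n_{k,i})=(2k)^{n-1}\deg_if\cdot O_3$. The joint degree $\deg_{1,2}f$ is defined as the integer with $f_{\mathsf E}(O^n_{k,\{1,2\}})=2^{n-2}k^{n-1}\deg_{1,2}f\cdot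 O_3$. -}

module Defs where

open import Data.Nat as ℕ using (ℕ; zero; suc; _+_)
open import Data.Fin using (Fin; zero; suc; toℕ)
open import Data.Fin.Properties using (all?)
open import Data.Integer as ℤ using (ℤ; +_; 0ℤ)
open import Data.Product using (_×_; _,_)
open import Data.Sum using (_⊎_)
open import Data.Bool using (Bool; true; false)
open import Relation.Nullary using (Dec; yes; no; ¬_)
open import Relation.Nullary.Decidable using (⌊_⌋; _×-dec_; _⊎-dec_)
open import Relation.Binary.PropositionalEquality using (_≡_)
open import Data.Vec.Functional using (_∷_)

-- ## The cycle C_m on Fin m
-- Step m u v : v = u + 1 (mod m), i.e. [u,v] is one of the edges of O_m
Step : (m : ℕ) → Fin m → Fin m → Set
Step m u v = (suc (toℕ u) ≡ toℕ v) ⊎ ((suc (toℕ u) ≡ m) × (toℕ v ≡ 0))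

step? : (m : ℕ) → (u v : Fin m) → Dec (Step m u v)
step? m u v = (suc (toℕ u) ℕ.≟ toℕ v) ⊎-dec ((suc (toℕ u) ℕ.≟ m) ×-dec (toℕ v ℕ.≟ 0))

Adj : (m : ℕ) → Fin m → Fin m → Set
Adj m u v = Step m u v ⊎ Step m v u

Vertex : ℕ → ℕ → Set
Vertex k n = Fin n → Fin k

PowAdj : (k n : ℕ) → Vertex k n → Vertex k n → Set
PowAdj k n a b = ∀ j → Adj k (a j) (b j)

powAdj? : (k n : ℕ) → (a b : Vertex k n) → Dec (PowAdj k n a b)
powAdj? k n a b = all? (λ j → step? k (a j) (b j) ⊎-dec step? k (b j) (a j))

IsPolymorphism : (k n : ℕ) → (Vertex k n → Fin 3) → Set
IsPolymorphism k n f = ∀ a b → PowAdj k n a b → Adj 3 (f a) (f b)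

-- ## Δ_E(C_3): free abelian group on oriented edges with [u,v] = -[v,u].
-- It is free on the three edges [j, j+1 mod 3]; we represent an element by
-- its coefficient vector w.r.t. this basis.
ΔE3 : Set
ΔE3 = Fin 3 → ℤ

ind : Bool → ℤ
ind true  = + 1
ind false = 0ℤ

-- the oriented edge [x,y] of C_3 as an element of Δ_E(C_3)
-- ( [j,j+1] ↦ +e_j ,  [j+1,j] ↦ -e_j ; non-edges are never used )
edge3 : Fin 3 → Fin 3 → ΔE3
edge3 x y j = ind ⌊ step? 3 x y ×-dec (x Data.Fin.≟ j) ⌋
              ℤ.- ind ⌊ step? 3 y x ×-dec (y Data.Fin.≟ j) ⌋

O3 : ΔE3
O3 j = + 1

_·_ : ℤ → ΔE3 → ΔE3
(c · x) j = c ℤ.* x j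

infixr 5 _·_

sumFin : (m : ℕ) → (Fin m → ℤ) → ℤ
sumFin zero    g = 0ℤ
sumFin (suc m) g = g zero ℤ.+ sumFin m (λ i → g (suc i))

sumVertex : (k n : ℕ) → (Vertex k n → ℤ) → ℤ
sumVertex k zero    g = g (λ ())
sumVertex k (suc n) g = sumFin k (λ x → sumVertex k n (λ v → g (x ∷ v)))

fE : (k n : ℕ) (S : Vertex k n → Vertex k n → Set) →
     (∀ a b → Dec (S a b)) → (Vertex k n → Fin 3) → ΔE3
fE k n S S? f j =
  sumVertex k n (λ a → sumVertex k n (λ b →
    ind ⌊ S? a b ⌋ ℤ.* edge3 (f a) (f b) j))

-- ## The edge sets O^n_{k,i} and O^n_{k,{i,i'}}
-- (coordinates are indexed from 0, so paper's coordinate 1 is zero, 2 is suc zero)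
InO : (k n : ℕ) → Fin n → Vertex k n → Vertex k n → Set
InO k n i a b = PowAdj k n a b × Step k (a i) (b i)

inO? : (k n : ℕ) (i : Fin n) → ∀ a b → Dec (InO k n i a b)
inO? k n i a b = powAdj? k n a b ×-dec step? k (a i) (b i)

InO₂ : (k n : ℕ) → Fin n → Fin n → Vertex k n → Vertex k n → Set
InO₂ k n i i' a b = InO k n i a b × InO k n i' a b

inO₂? : (k n : ℕ) (i i' : Fin n) → ∀ a b → Dec (InO₂ k n i i' a b)
inO₂? k n i i' a b = inO? k n i a b ×-dec inO? k n i' a b

IsDeg : (k n : ℕ) → Fin (suc n) → (Vertex k (suc n) → Fin 3) → ℤ → Set
IsDeg k n i f d =
  ∀ j → fE k (suc n) (InO k (suc n) i) (inO? k (suc n) i) f j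
        ≡ ((+ ((2 ℕ.* k) ℕ.^ n)) ℤ.* d · O3) j

-- Since k ≥ 3, every edge [a,b] of C_k^n runs in each coordinate either forward (b_i = a_i + 1)
-- or backward, never both.  Hence [forward in i] + [forward in i'] equals 2 [forward in both]
-- plus the indicators of the edge sets T (forward in i, backward in i') and T⁻¹ (the reverses
-- of T).  Applying f_E, the contributions of T and T⁻¹ cancel because [u,v] = -[v,u], so
-- f_E(O_i) + f_E(O_i') = 2 f_E(O_{i,i'}); the theorem follows after halving, as
-- (2k)^{n-1} = 2 · 2^{n-2} k^{n-1}.
module Submission where

open import Defs
open import Data.Nat using (ℕ; _≤_; _+_; _*_; _^_)
open import Data.Nat.Divisibility using (_∣_)
open import Data.Fin using (Fin; zero; suc)
open import Data.Integer as ℤ using (ℤ; +_)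
open import Relation.Nullary using (¬_)
open import Relation.Binary.PropositionalEquality using (_≡_)

open import Data.Nat as ℕ using (suc; s≤s)
import Data.Nat.Properties as ℕP
import Data.Integer.Properties as ℤP
open import Algebra.Properties.CommutativeSemigroup ℕP.*-commutativeSemigroup using (interchange)
open import Algebra.Properties.AbelianGroup ℤP.+-0-abelianGroup using (⁻¹-anti-homo‿-)
open import Data.Integer.Tactic.RingSolver using (solve-∀)
open import Algebra.Properties.CommutativeMonoid.Sum ℤP.+-0-commutativeMonoid
  using (sum; ∑-distrib-+; sum-replicate-zero)
open import Data.Product using (_×_; _,_)
open import Data.Sum using (_⊎_; inj₁; inj₂; [_,_]′; swap)
open import Data.Vec.Functional using (_∷_)
open import Function using (_∘_)
open import Relation.Binary.Definitions using (Symmetric; Asymmetric)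
open import Relation.Nullary using (Dec; yes; no; contradiction)
open import Relation.Nullary.Decidable using (⌊_⌋; _×-dec_)
open import Relation.Binary.PropositionalEquality
  using (refl; sym; trans; cong; cong₂; _≗_; module ≡-Reasoning)
open ≡-Reasoning

sumFin≡sum : ∀ m (g : Fin m → ℤ) → sumFin m g ≡ sum g
sumFin≡sum ℕ.zero  g = refl
sumFin≡sum (suc m) g = cong (λ s → g zero ℤ.+ s) (sumFin≡sum m (g ∘ suc))

sumFin-cong : ∀ m {g h : Fin m → ℤ} → g ≗ h → sumFin m g ≡ sumFin m h
sumFin-cong ℕ.zero  g≗h = refl
sumFin-cong (suc m) g≗h = cong₂ ℤ._+_ (g≗h zero) (sumFin-cong m (g≗h ∘ suc))

sumFin-zero : ∀ m → sumFin m (λ _ → + 0) ≡ + 0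
sumFin-zero m = trans (sumFin≡sum m _) (sum-replicate-zero m)

sumFin-distrib-+ : ∀ m (g h : Fin m → ℤ) →
  sumFin m (λ i → g i ℤ.+ h i) ≡ sumFin m g ℤ.+ sumFin m h
sumFin-distrib-+ m g h = begin
  sumFin m (λ i → g i ℤ.+ h i) ≡⟨ sumFin≡sum m _ ⟩
  sum (λ i → g i ℤ.+ h i)      ≡⟨ ∑-distrib-+ g h ⟩
  sum g ℤ.+ sum h              ≡⟨ cong₂ ℤ._+_ (sumFin≡sum m g) (sumFin≡sum m h) ⟨
  sumFin m g ℤ.+ sumFin m h    ∎

sumFin-comm : ∀ m p (F : Fin m → Fin p → ℤ) →
  sumFin m (λ i → sumFin p (F i)) ≡ sumFin p (λ j → sumFin m (λ i → F i j))
sumFin-comm ℕ.zero  p F = sym (sumFin-zero p)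
sumFin-comm (suc m) p F =
  trans (cong (λ s → sumFin p (F zero) ℤ.+ s) (sumFin-comm m p (F ∘ suc)))
        (sym (sumFin-distrib-+ p (F zero) _))

sumVertex-cong : ∀ k n {g h : Vertex k n → ℤ} → g ≗ h → sumVertex k n g ≡ sumVertex k n h
sumVertex-cong k ℕ.zero  g≗h = g≗h _
sumVertex-cong k (suc n) g≗h = sumFin-cong k (λ x → sumVertex-cong k n (λ v → g≗h (x ∷ v)))

sumVertex-zero : ∀ k n → sumVertex k n (λ _ → + 0) ≡ + 0
sumVertex-zero k ℕ.zero  = refl
sumVertex-zero k (suc n) = trans (sumFin-cong k (λ _ → sumVertex-zero k n)) (sumFin-zero k)

sumVertex-distrib-+ : ∀ k n (g h : Vertex k n → ℤ) →
  sumVertex k n (λ a → g a ℤ.+ h a) ≡ sumVertex k n g ℤ.+ sumVertex k n h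
sumVertex-distrib-+ k ℕ.zero  g h = refl
sumVertex-distrib-+ k (suc n) g h =
  trans (sumFin-cong k (λ x → sumVertex-distrib-+ k n _ _)) (sumFin-distrib-+ k _ _)

sumVertex-sumFin-comm : ∀ k n p (F : Vertex k n → Fin p → ℤ) →
  sumVertex k n (λ a → sumFin p (F a)) ≡ sumFin p (λ j → sumVertex k n (λ a → F a j))
sumVertex-sumFin-comm k ℕ.zero  p F = refl
sumVertex-sumFin-comm k (suc n) p F =
  trans (sumFin-cong k (λ x → sumVertex-sumFin-comm k n p (λ v → F (x ∷ v))))
        (sumFin-comm k p _)

sumVertex-comm : ∀ k n n′ (F : Vertex k n → Vertex k n′ → ℤ) →
  sumVertex k n (λ a → sumVertex k n′ (F a)) ≡ sumVertex k n′ (λ b → sumVertex k n (λ a → F a b))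
sumVertex-comm k n ℕ.zero   F = refl
sumVertex-comm k n (suc n′) F =
  trans (sumVertex-sumFin-comm k n k (λ a x → sumVertex k n′ (λ v → F a (x ∷ v))))
        (sumFin-cong k (λ x → sumVertex-comm k n n′ (λ a v → F a (x ∷ v))))

sumPairs : (k n : ℕ) → (Vertex k n → Vertex k n → ℤ) → ℤ
sumPairs k n F = sumVertex k n (λ a → sumVertex k n (F a))

module _ (k n : ℕ) where

  sumPairs-cong : {F G : Vertex k n → Vertex k n → ℤ} →
    (∀ a b → F a b ≡ G a b) → sumPairs k n F ≡ sumPairs k n G
  sumPairs-cong F≡G = sumVertex-cong k n (λ a → sumVertex-cong k n (F≡G a))

  sumPairs-distrib-+ : (F G : Vertex k n → Vertex k n → ℤ) →
    sumPairs k n (λ a b → F a b ℤ.+ G a b) ≡ sumPairs k n F ℤ.+ sumPairs k n G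
  sumPairs-distrib-+ F G =
    trans (sumVertex-cong k n (λ a → sumVertex-distrib-+ k n (F a) (G a)))
          (sumVertex-distrib-+ k n _ _)

  sumPairs-antisymmetric : (K : Vertex k n → Vertex k n → ℤ) →
    (∀ a b → K b a ≡ ℤ.- K a b) → sumPairs k n K ≡ + 0
  sumPairs-antisymmetric K K-antisym = ℤP.*-cancelˡ-≡ (+ 2) S (+ 0) (begin
    + 2 ℤ.* S                                   ≡⟨ double S ⟩
    S ℤ.+ S
      ≡⟨ cong (λ s → S ℤ.+ s) (sumVertex-comm k n n (λ a b → K b a)) ⟨
    S ℤ.+ sumPairs k n (λ a b → K b a)          ≡⟨ sumPairs-distrib-+ K (λ a b → K b a) ⟨
    sumPairs k n (λ a b → K a b ℤ.+ K b a)      ≡⟨ sumPairs-cong cancel ⟩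
    sumPairs k n (λ _ _ → + 0)                  ≡⟨ sumVertex-cong k n (λ _ → sumVertex-zero k n) ⟩
    sumVertex k n (λ _ → + 0)                   ≡⟨ sumVertex-zero k n ⟩
    + 0                                         ∎)
    where
    S = sumPairs k n K
    double : ∀ x → + 2 ℤ.* x ≡ x ℤ.+ x
    double = solve-∀
    cancel : ∀ a b → K a b ℤ.+ K b a ≡ + 0
    cancel a b = trans (cong (λ s → K a b ℤ.+ s) (K-antisym a b)) (ℤP.+-inverseʳ (K a b))

successor-mod-asymmetric : ∀ {m x y} → 3 ≤ m →
  (suc x ≡ y) ⊎ (suc x ≡ m × y ≡ 0) → ¬ ((suc y ≡ x) ⊎ (suc y ≡ m × x ≡ 0))
successor-mod-asymmetric {x = x} _ (inj₁ refl) (inj₁ 2+x≡x) = ℕP.m≢1+n+m x (sym 2+x≡x)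
successor-mod-asymmetric (s≤s (s≤s ())) (inj₁ refl) (inj₂ (refl , refl))
successor-mod-asymmetric (s≤s (s≤s ())) (inj₂ (refl , refl)) (inj₁ refl)

Step-asymmetric : ∀ {m} → 3 ≤ m → Asymmetric (Step m)
Step-asymmetric 3≤m = successor-mod-asymmetric 3≤m

PowAdj-sym : ∀ {k n} → Symmetric (PowAdj k n)
PowAdj-sym adj j = swap (adj j)

data Oriented {S T : Set} : Dec S → Dec T → Set where
  forward  : ∀ {s ¬t} → Oriented (yes s) (no ¬t)
  backward : ∀ {¬s t} → Oriented (no ¬s) (yes t)

oriented : ∀ {S T : Set} (s? : Dec S) (t? : Dec T) → S ⊎ T → (S → ¬ T) → Oriented s? t?
oriented (yes s) (yes t) _      s⇒¬t = contradiction t (s⇒¬t s)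
oriented (yes _) (no _)  _      _    = forward
oriented (no _)  (yes _) _      _    = backward
oriented (no ¬s) (no ¬t) s⊎t    _    = contradiction s⊎t [ ¬s , ¬t ]′

Adj-oriented : ∀ {m} → 3 ≤ m → (u v : Fin m) → Adj m u v → Oriented (step? m u v) (step? m v u)
Adj-oriented 3≤m u v adj = oriented (step? _ u v) (step? _ v u) adj (Step-asymmetric 3≤m)

𝟙 : {A : Set} → Dec A → ℤ
𝟙 a? = ind ⌊ a? ⌋

indicator-split : {P P′ S₀ T₀ S₁ T₁ : Set}
  (p : Dec P) (p′ : Dec P′) {s₀ : Dec S₀} {t₀ : Dec T₀} {s₁ : Dec S₁} {t₁ : Dec T₁} →
  (P → P′) → (P′ → P) → (P → Oriented s₀ t₀) → (P → Oriented s₁ t₁) →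
  𝟙 (p ×-dec s₀) ℤ.+ 𝟙 (p ×-dec s₁)
    ≡ (𝟙 ((p ×-dec s₀) ×-dec (p ×-dec s₁)) ℤ.+ 𝟙 ((p ×-dec s₀) ×-dec (p ×-dec s₁)))
      ℤ.+ (𝟙 ((p ×-dec s₀) ×-dec t₁) ℤ.+ 𝟙 ((p′ ×-dec t₀) ×-dec s₁))
indicator-split (no ¬p) (yes p′) _    p′⇒p _  _  = contradiction (p′⇒p p′) ¬p
indicator-split (no _)  (no _)   _    _    _  _  = refl
indicator-split (yes p) (no ¬p′) p⇒p′ _    _  _  = contradiction (p⇒p′ p) ¬p′
indicator-split (yes p) (yes _)  _    _    o₀ o₁ with o₀ p | o₁ p
... | forward  | forward  = refl
... | forward  | backward = refl
... | backward | forward  = refl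
... | backward | backward = refl

edge3-antisym : ∀ x y j → edge3 y x j ≡ ℤ.- edge3 x y j
edge3-antisym x y j = sym (⁻¹-anti-homo‿- (ind ⌊ step? 3 x y ×-dec (x Data.Fin.≟ j) ⌋)
                                            (ind ⌊ step? 3 y x ×-dec (y Data.Fin.≟ j) ⌋))

fE-O+fE-O : ∀ {k n} → 3 ≤ k → (f : Vertex k n → Fin 3) (i i′ : Fin n) (j : Fin 3) →
  fE k n (InO k n i) (inO? k n i) f j ℤ.+ fE k n (InO k n i′) (inO? k n i′) f j
    ≡ fE k n (InO₂ k n i i′) (inO₂? k n i i′) f j ℤ.+ fE k n (InO₂ k n i i′) (inO₂? k n i i′) f j
fE-O+fE-O {k} {n} 3≤k f i i′ j = begin
  sumPairs k n L ℤ.+ sumPairs k n L′                 ≡⟨ sumPairs-distrib-+ k n L L′ ⟨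
  sumPairs k n (λ a b → L a b ℤ.+ L′ a b)             ≡⟨ sumPairs-cong k n split ⟩
  sumPairs k n (λ a b → (X a b ℤ.+ X a b) ℤ.+ K a b)  ≡⟨ sumPairs-distrib-+ k n _ K ⟩
  sumPairs k n (λ a b → X a b ℤ.+ X a b) ℤ.+ sumPairs k n K
    ≡⟨ cong₂ ℤ._+_ (sumPairs-distrib-+ k n X X) (sumPairs-antisymmetric k n K K-antisym) ⟩
  (sumPairs k n X ℤ.+ sumPairs k n X) ℤ.+ + 0         ≡⟨ ℤP.+-identityʳ _ ⟩
  sumPairs k n X ℤ.+ sumPairs k n X                   ∎
  where
  g : Vertex k n → Vertex k n → ℤ
  g a b = edge3 (f a) (f b) j
  L L′ X T K : Vertex k n → Vertex k n → ℤ
  L  a b = 𝟙 (inO? k n i a b) ℤ.* g a b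
  L′ a b = 𝟙 (inO? k n i′ a b) ℤ.* g a b
  X  a b = 𝟙 (inO₂? k n i i′ a b) ℤ.* g a b
  T  a b = 𝟙 (inO? k n i a b ×-dec step? k (b i′) (a i′)) ℤ.* g a b
  K  a b = T a b ℤ.- T b a
  K-antisym : ∀ a b → K b a ≡ ℤ.- K a b
  K-antisym a b = sym (⁻¹-anti-homo‿- (T a b) (T b a))
  regroup : ∀ c d e x →
    ((c ℤ.+ c) ℤ.+ (d ℤ.+ e)) ℤ.* x ≡ (c ℤ.* x ℤ.+ c ℤ.* x) ℤ.+ (d ℤ.* x ℤ.- e ℤ.* ℤ.- x)
  regroup = solve-∀
  split : ∀ a b → L a b ℤ.+ L′ a b ≡ (X a b ℤ.+ X a b) ℤ.+ K a b
  split a b = begin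
    L a b ℤ.+ L′ a b  ≡⟨ ℤP.*-distribʳ-+ (g a b) (𝟙 (inO? k n i a b)) (𝟙 (inO? k n i′ a b)) ⟨
    (𝟙 (inO? k n i a b) ℤ.+ 𝟙 (inO? k n i′ a b)) ℤ.* g a b
      ≡⟨ cong (ℤ._* g a b) (indicator-split (powAdj? k n a b) (powAdj? k n b a)
                             PowAdj-sym PowAdj-sym
                             (λ adj → Adj-oriented 3≤k (a i) (b i) (adj i))
                             (λ adj → Adj-oriented 3≤k (a i′) (b i′) (adj i′))) ⟩
    ((c ℤ.+ c) ℤ.+ (d ℤ.+ e)) ℤ.* g a b  ≡⟨ regroup c d e (g a b) ⟩
    (X a b ℤ.+ X a b) ℤ.+ (T a b ℤ.- e ℤ.* ℤ.- g a b)
      ≡⟨ cong (λ x → (X a b ℤ.+ X a b) ℤ.+ (T a b ℤ.- e ℤ.* x)) (edge3-antisym (f a) (f b) j) ⟨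
    (X a b ℤ.+ X a b) ℤ.+ K a b          ∎
    where
    c = 𝟙 (inO₂? k n i i′ a b)
    d = 𝟙 (inO? k n i a b ×-dec step? k (b i′) (a i′))
    e = 𝟙 (inO? k n i b a ×-dec step? k (a i′) (b i′))

^-distrib-* : ∀ m n o → (m * n) ^ o ≡ m ^ o * n ^ o
^-distrib-* m n ℕ.zero    = refl
^-distrib-* m n (suc o) =
  trans (cong (m * n *_) (^-distrib-* m n o)) (interchange m n (m ^ o) (n ^ o))

lemma5p10 : (k m : ℕ) → 3 ≤ k → ¬ (2 ∣ k) →
    (f : Vertex k (2 + m) → Fin 3) → IsPolymorphism k (2 + m) f →
    (d₁ d₂ : ℤ) → IsDeg k (1 + m) zero f d₁ → IsDeg k (1 + m) (suc zero) f d₂ →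
    ∀ j → fE k (2 + m) (InO₂ k (2 + m) zero (suc zero)) (inO₂? k (2 + m) zero (suc zero)) f j
          ≡ ((+ (2 ^ m * k ^ (1 + m))) ℤ.* (d₁ ℤ.+ d₂) · O3) j
lemma5p10 k m 3≤k _ f _ d₁ d₂ deg₁ deg₂ j = ℤP.*-cancelˡ-≡ (+ 2) S₁₂ _ (begin
  + 2 ℤ.* S₁₂                                    ≡⟨ double S₁₂ ⟩
  S₁₂ ℤ.+ S₁₂                                    ≡⟨ fE-O+fE-O 3≤k f zero (suc zero) j ⟨
  S₁ ℤ.+ S₂                                      ≡⟨ cong₂ ℤ._+_ (deg₁ j) (deg₂ j) ⟩
  (+ N ℤ.* d₁) ℤ.* + 1 ℤ.+ (+ N ℤ.* d₂) ℤ.* + 1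
                                                 ≡⟨ cong (λ x → (x ℤ.* d₁) ℤ.* + 1 ℤ.+ (x ℤ.* d₂) ℤ.* + 1) N≡2M ⟩
  (+ 2 ℤ.* + M ℤ.* d₁) ℤ.* + 1 ℤ.+ (+ 2 ℤ.* + M ℤ.* d₂) ℤ.* + 1
                                                 ≡⟨ factor (+ M) d₁ d₂ ⟩
  + 2 ℤ.* ((+ M ℤ.* (d₁ ℤ.+ d₂)) ℤ.* + 1)        ∎)
  where
  S₁ S₂ S₁₂ : ℤ
  S₁  = fE k (2 + m) (InO k (2 + m) zero) (inO? k (2 + m) zero) f j
  S₂  = fE k (2 + m) (InO k (2 + m) (suc zero)) (inO? k (2 + m) (suc zero)) f j
  S₁₂ = fE k (2 + m) (InO₂ k (2 + m) zero (suc zero)) (inO₂? k (2 + m) zero (suc zero)) f j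
  N M : ℕ
  N = (2 * k) ^ (1 + m)
  M = 2 ^ m * k ^ (1 + m)
  N≡2M : + N ≡ + 2 ℤ.* + M
  N≡2M = trans (cong +_ (trans (^-distrib-* 2 k (1 + m)) (ℕP.*-assoc 2 (2 ^ m) (k ^ (1 + m)))))
               (ℤP.pos-* 2 M)
  double : ∀ x → + 2 ℤ.* x ≡ x ℤ.+ x
  double = solve-∀
  factor : ∀ x d₁ d₂ → (+ 2 ℤ.* x ℤ.* d₁) ℤ.* + 1 ℤ.+ (+ 2 ℤ.* x ℤ.* d₂) ℤ.* + 1
                       ≡ + 2 ℤ.* ((x ℤ.* (d₁ ℤ.+ d₂)) ℤ.* + 1)
  factor = solve-∀
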